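{- Let $\phi(a,b,c,d)=(ab+cd)(ac-bd)$. For arbitrary parameters $p,q,r,s$, define \[ \begin{aligned} X_1&=\phi(p,q,r,s), & X_2&=\phi(p,r,s,q), & X_3&=\phi(p,s,q,r),\\ Y_1&=\phi(p,q,s,r), & Y_2&=\phi(p,r,q,s), & Y_3&=\phi(p,s,r,q). \end{aligned} \] Then $X_1^2+X_2^2+X_3^2=Y_1^2+Y_2^2+Y_3^2$ and $X_1X_2X_3=Y_1Y_2Y_3$.
   Context: Parameters $p,q,r,s$ are arbitrary integers (or rationals). -}

module Defs where

open import Data.Integer using (ℤ; _+_; _*_; _-_)

φ : ℤ → ℤ → ℤ → ℤ → ℤ
φ a b c d = (a * b + c * d) * (a * c - b * d)

module Submission where

open import Defs
open import Data.Integer using (ℤ; _+_; _*_; _-_; _^_)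
open import Data.Integer.Solver using (module +-*-Solver)
open import Data.Product using (_×_; _,_)
open import Relation.Binary.PropositionalEquality using (_≡_; refl)

open +-*-Solver

-- φ as a solver expression: its semantics unfolds definitionally to φ, so the
-- solver's output applies to the statements about φ without any rewriting.
Φ : ∀ {n} → Polynomial n → Polynomial n → Polynomial n → Polynomial n → Polynomial n
Φ a b c d = (a :* b :+ c :* d) :* (a :* c :- b :* d)

φ-square-sum-identity : ∀ p q r s →
  φ p q r s ^ 2 + φ p r s q ^ 2 + φ p s q r ^ 2 ≡ φ p q s r ^ 2 + φ p r q s ^ 2 + φ p s r q ^ 2
φ-square-sum-identity = solve 4 (λ p q r s →
  Φ p q r s :^ 2 :+ Φ p r s q :^ 2 :+ Φ p s q r :^ 2 := Φ p q s r :^ 2 :+ Φ p r q s :^ 2 :+ Φ p s r q :^ 2) refl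

φ-product-identity : ∀ p q r s →
  φ p q r s * φ p r s q * φ p s q r ≡ φ p q s r * φ p r q s * φ p s r q
φ-product-identity = solve 4 (λ p q r s →
  Φ p q r s :* Φ p r s q :* Φ p s q r := Φ p q s r :* Φ p r q s :* Φ p s r q) refl

theorem2 : (p q r s : ℤ) →
    ((φ p q r s) ^ 2 + (φ p r s q) ^ 2 + (φ p s q r) ^ 2
      ≡ (φ p q s r) ^ 2 + (φ p r q s) ^ 2 + (φ p s r q) ^ 2)
    × (φ p q r s * φ p r s q * φ p s q r
      ≡ φ p q s r * φ p r q s * φ p s r q)
theorem2 p q r s = φ-square-sum-identity p q r s , φ-product-identity p q r s
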